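{- Let $r\ge 3$, let $H$ be an $r$-color-critical (multi)graph with $h$ edges, let $k\ge h$ be an integer and $k^*=\frac{r-1}{r-2}(h-1)$. For each $n$ let $A(n)=(h-1)K_n$ if $h\le k<k^*$ and $A(n)=kT_{r-1}(n)$ if $k\ge k^*$. Suppose there is $M_0>0$ such that for all $n>M_0$, $A(n)$ is the unique $n$-vertex simply $k$-colored multicolored-$H$-free multigraph with at least $e(A(n))$ edges and minimum degree at least $\delta(A(n))$. Then there exists $n_0=n_0(M_0,k)>0$ such that for all $n>n_0$, $A(n)$ is the unique $n$-vertex $k$-color extremal multigraph of $H$.
   Context: Multigraphs have no loops; $w_G(uv)$ denotes multiplicity, $e(G)$ the number of edges with multiplicity, degrees count multiplicity and $\delta(G)$ is the minimum degree. A simple $k$-coloring of a multigraph is a decomposition of its edge multiset as a disjoint sum of $k$ simple graphs (colors); $G$ with such a decomposition is simply $k$-colored. $G$ contains a multicolored copy of $H$ if there is an injection $\phi:V(H)\to V(G)$ and, for each pair $xy$ of $V(H)$, $w_H(xy)$ edges of $G$ between $\phi(x),\phi(y)$, all chosen edges having distinct colors; otherwise $G$ is multicolored-$H$-free. $\mathrm{ex}_k(n,H)$ is the maximum number of edges of an $n$-vertex simply $k$-colored multicolored-$H$-free multigraph, and those attaining it are the $k$-color extremal multigraphs. A (multi)graph is $r$-color-critical if it has chromatic number $r$ and has an edge whose removal (reducing multiplicity by one) lowers the chromatic number to $r-1$. $(h-1)K_n$ is the $n$-vertex multigraph with $h-1$ colors each equal to $K_n$ (other colors empty); $kT_{r-1}(n)$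 is the multigraph with all $k$ colors equal to the same balanced complete $(r-1)$-partite graph $T_{r-1}(n)$. -}

module Defs where

open import Data.Nat using (ℕ; zero; suc; _+_; _*_; _∸_; _≤_; _<_; _<ᵇ_; _⊓_; _%_)
open import Data.Bool using (Bool; true; false; if_then_else_; _∧_; _∨_)
open import Data.Bool.Properties using (∨-comm; ∧-zeroʳ)
open import Data.Fin using (Fin; toℕ) renaming (zero to fz; suc to fs)
import Data.Fin as F
open import Data.Product using (Σ; _×_; ∃)
open import Relation.Nullary using (¬_)
open import Relation.Nullary.Decidable using (⌊_⌋)
open import Relation.Binary.PropositionalEquality using (_≡_; _≢_; refl; cong; trans)
open import Function.Bundles using (_↔_; Inverse)
open import Function.Definitions using (Injective)

sumFin : ∀ n → (Fin n → ℕ) → ℕ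
sumFin zero    f = 0
sumFin (suc n) f = f fz + sumFin n (λ i → f (fs i))

-- minimum over Fin n (convention: 0 for n = 0; only used for n ≥ 1)
minFin : ∀ n → (Fin n → ℕ) → ℕ
minFin zero          f = 0
minFin (suc zero)    f = f fz
minFin (suc (suc n)) f = f fz ⊓ minFin (suc n) (λ i → f (fs i))

b2n : Bool → ℕ
b2n true  = 1
b2n false = 0

countTrue : ∀ k → (Fin k → Bool) → ℕ
countTrue k S = sumFin k (λ c → b2n (S c))

record MG (m : ℕ) : Set where
  field
    w     : Fin m → Fin m → ℕ
    w-sym : ∀ x y → w x y ≡ w y x
    loopless : ∀ x → w x x ≡ 0
open MG public

eMG : ∀ {m} → MG m → ℕ
eMG {m} H = sumFin m (λ x → sumFin m (λ y → if toℕ y <ᵇ toℕ x then w H x y else 0))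

Colorable : ∀ {m} → (Fin m → Fin m → ℕ) → ℕ → Set
Colorable {m} ω q = Σ (Fin m → Fin q) λ f → ∀ x y → 0 < ω x y → f x ≢ f y

HasChi : ∀ {m} → (Fin m → Fin m → ℕ) → ℕ → Set
HasChi ω q = Colorable ω q × ¬ Colorable ω (q ∸ 1)

removeEdge : ∀ {m} → (Fin m → Fin m → ℕ) → Fin m → Fin m → Fin m → Fin m → ℕ
removeEdge ω x y a b =
  if (⌊ a F.≟ x ⌋ ∧ ⌊ b F.≟ y ⌋) ∨ (⌊ a F.≟ y ⌋ ∧ ⌊ b F.≟ x ⌋)
  then ω a b ∸ 1 else ω a b

ColorCritical : ℕ → ∀ {m} → MG m → Set
ColorCritical r {m} H =
  HasChi (w H) r ×
  Σ (Fin m) λ x → Σ (Fin m) λ y → 0 < w H x y × HasChi (removeEdge (w H) x y) (r ∸ 1)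

-- Simply k-colored multigraphs on Fin n: k simple graphs (the colours)

record CMG (k n : ℕ) : Set where
  field
    col     : Fin k → Fin n → Fin n → Bool
    col-sym : ∀ c u v → col c u v ≡ col c v u
    col-irr : ∀ c u → col c u u ≡ false
open CMG public

mult : ∀ {k n} → CMG k n → Fin n → Fin n → ℕ
mult {k} G u v = countTrue k (λ c → col G c u v)

eG : ∀ {k n} → CMG k n → ℕ
eG {k} {n} G = sumFin n (λ u → sumFin n (λ v → if toℕ v <ᵇ toℕ u then mult G u v else 0))

deg : ∀ {k n} → CMG k n → Fin n → ℕ
deg {k} {n} G u = sumFin n (λ v → mult G u v)

minDeg : ∀ {k n} → CMG k n → ℕ
minDeg {k} {n} G = minFin n (deg G)

record MultiCopy {m k n} (H : MG m) (G : CMG k n) : Set where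
  field
    φ      : Fin m → Fin n
    φ-inj  : Injective _≡_ _≡_ φ
    -- the set of colours chosen for the pair {x,y}, y < x
    S      : Fin m → Fin m → Fin k → Bool
    S-size : ∀ x y → toℕ y < toℕ x → countTrue k (S x y) ≡ w H x y
    S-edge : ∀ x y c → toℕ y < toℕ x → S x y c ≡ true → col G c (φ x) (φ y) ≡ true
    S-disj : ∀ x y x' y' c → toℕ y < toℕ x → toℕ y' < toℕ x' →
             S x y c ≡ true → S x' y' c ≡ true → (x ≡ x') × (y ≡ y')

Free : ∀ {m k n} → MG m → CMG k n → Set
Free H G = ¬ MultiCopy H G

Extremal : ∀ {m k n} → MG m → CMG k n → Set
Extremal {k = k} {n} H G = Free H G × (∀ (G' : CMG k n) → Free H G' → eG G' ≤ eG G)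

_≅_ : ∀ {k n} → CMG k n → CMG k n → Set
_≅_ {k} {n} G G' = Σ (Fin n ↔ Fin n) λ π → Σ (Fin k ↔ Fin k) λ τ →
  ∀ c u v → col G c u v ≡ col G' (Inverse.to τ c) (Inverse.to π u) (Inverse.to π v)

neqᵇ : ℕ → ℕ → Bool
neqᵇ a b = (a <ᵇ b) ∨ (b <ᵇ a)

neqᵇ-sym : ∀ a b → neqᵇ a b ≡ neqᵇ b a
neqᵇ-sym a b = ∨-comm (a <ᵇ b) (b <ᵇ a)

<ᵇ-irr : ∀ a → (a <ᵇ a) ≡ false
<ᵇ-irr zero    = refl
<ᵇ-irr (suc a) = <ᵇ-irr a

neqᵇ-irr : ∀ a → neqᵇ a a ≡ false
neqᵇ-irr a rewrite <ᵇ-irr a = refl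

hKn : ∀ h k n → CMG k n
hKn h k n = record
  { col     = λ c u v → (toℕ c <ᵇ (h ∸ 1)) ∧ neqᵇ (toℕ u) (toℕ v)
  ; col-sym = λ c u v → cong ((toℕ c <ᵇ (h ∸ 1)) ∧_) (neqᵇ-sym (toℕ u) (toℕ v))
  ; col-irr = λ c u → trans (cong ((toℕ c <ᵇ (h ∸ 1)) ∧_) (neqᵇ-irr (toℕ u))) (∧-zeroʳ _) }

-- T_{r-1}(n): vertex u lies in part (u mod (r-1)); this is the balanced
-- complete (r-1)-partite graph (for r ≥ 2).  kT_{r-1}(n): every colour equals it.
part : ℕ → ∀ {n} → Fin n → ℕ
part r u = toℕ u % suc (r ∸ 2)

kT : ∀ r k n → CMG k n
kT r k n = record
  { col     = λ c u v → neqᵇ (part r u) (part r v)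
  ; col-sym = λ c u v → neqᵇ-sym (part r u) (part r v)
  ; col-irr = λ c u → neqᵇ-irr (part r u) }

-- A(n): (h-1)K_n if k < k* = (r-1)(h-1)/(r-2), i.e. k(r-2) < (r-1)(h-1);
-- kT_{r-1}(n) if k ≥ k*.
A : (r h k n : ℕ) → CMG k n
A r h k n = if (k * (r ∸ 2)) <ᵇ ((r ∸ 1) * (h ∸ 1)) then hKn h k n else kT r k n

-- A(n) minus a vertex is A(n-1), so deleting from a free G with e(G) ≥ e(A(n)) + t
-- a vertex u of degree below δ(A(n)) leaves e(G - u) ≥ e(A(n-1)) + t + 1.
-- Above M₀ these deletions can only stop at a graph of minimum degree ≥ δ(A),
-- which by degree-stability is A itself and has no surplus.  So a free G ≇ A(n)
-- with e(G) ≥ e(A(n)) reaches M₀ vertices with surplus > n - M₀, while a graph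
-- on M₀ vertices has at most M₀²k edges; hence n ≤ M₀²k + M₀.
module Submission where

open import Defs
open import Data.Nat using (ℕ; zero; suc; _+_; _*_; _∸_; _≤_; _<_; _<ᵇ_; z≤n; s≤s; _≤?_)
open import Data.Nat.Properties
open import Data.Bool using (true; false; if_then_else_)
open import Data.Fin using (Fin; toℕ; punchIn; fromℕ) renaming (zero to fz; suc to fs)
open import Data.Fin.Properties using (punchIn-injective; toℕ-injective; all?; ¬∀⟶∃¬)
open import Data.Product using (Σ; _×_; _,_; proj₁; proj₂)
open import Data.Sum using (_⊎_; inj₁; inj₂)
open import Data.Empty using (⊥-elim)
open import Relation.Nullary using (yes; no; ofʸ; ofⁿ)
open import Relation.Binary.PropositionalEquality
open import Function.Bundles using (_↔_; Inverse)
open import Algebra.Properties.CommutativeSemigroup +-commutativeSemigroup using (interchange)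
open import Algebra.Properties.CommutativeMonoid.Sum +-0-commutativeMonoid
  using (sum; sum-remove; ∑-distrib-+; ∑-permute)

sumFin≡sum : ∀ n (f : Fin n → ℕ) → sumFin n f ≡ sum f
sumFin≡sum zero    f = refl
sumFin≡sum (suc n) f = cong (f fz +_) (sumFin≡sum n (λ i → f (fs i)))

sumFin-cong : ∀ n {f g : Fin n → ℕ} → (∀ i → f i ≡ g i) → sumFin n f ≡ sumFin n g
sumFin-cong zero    f≗g = refl
sumFin-cong (suc n) f≗g = cong₂ _+_ (f≗g fz) (sumFin-cong n (λ i → f≗g (fs i)))

sumFin-zero : ∀ n → sumFin n (λ _ → 0) ≡ 0
sumFin-zero zero    = refl
sumFin-zero (suc n) = sumFin-zero n

sumFin-distrib-+ : ∀ n (f g : Fin n → ℕ) →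
  sumFin n (λ i → f i + g i) ≡ sumFin n f + sumFin n g
sumFin-distrib-+ n f g = begin
  sumFin n (λ i → f i + g i) ≡⟨ sumFin≡sum n _ ⟩
  sum (λ i → f i + g i)      ≡⟨ ∑-distrib-+ f g ⟩
  sum f + sum g              ≡⟨ sym (cong₂ _+_ (sumFin≡sum n f) (sumFin≡sum n g)) ⟩
  sumFin n f + sumFin n g    ∎
  where open ≡-Reasoning

sumFin-remove : ∀ n (v : Fin (suc n)) (f : Fin (suc n) → ℕ) →
  sumFin (suc n) f ≡ f v + sumFin n (λ i → f (punchIn v i))
sumFin-remove n v f = begin
  sumFin (suc n) f                     ≡⟨ sumFin≡sum (suc n) f ⟩
  sum f                                ≡⟨ sum-remove {i = v} f ⟩
  f v + sum (λ i → f (punchIn v i))    ≡⟨ cong (f v +_) (sym (sumFin≡sum n _)) ⟩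
  f v + sumFin n (λ i → f (punchIn v i)) ∎
  where open ≡-Reasoning

sumFin-permute : ∀ n (π : Fin n ↔ Fin n) (f : Fin n → ℕ) →
  sumFin n (λ i → f (Inverse.to π i)) ≡ sumFin n f
sumFin-permute n π f = begin
  sumFin n (λ i → f (Inverse.to π i)) ≡⟨ sumFin≡sum n _ ⟩
  sum (λ i → f (Inverse.to π i))      ≡⟨ sym (∑-permute f π) ⟩
  sum f                               ≡⟨ sym (sumFin≡sum n f) ⟩
  sumFin n f                          ∎
  where open ≡-Reasoning

sumFin-comm : ∀ m n (f : Fin m → Fin n → ℕ) →
  sumFin m (λ i → sumFin n (f i)) ≡ sumFin n (λ j → sumFin m (λ i → f i j))
sumFin-comm zero    n f = sym (sumFin-zero n)
sumFin-comm (suc m) n f = trans (cong (sumFin n (f fz) +_) (sumFin-comm m n (λ i → f (fs i))))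
                                (sym (sumFin-distrib-+ n (f fz) _))

sumFin-≤ : ∀ n (f : Fin n → ℕ) {c} → (∀ i → f i ≤ c) → sumFin n f ≤ n * c
sumFin-≤ zero    f f≤c = z≤n
sumFin-≤ (suc n) f f≤c = +-mono-≤ (f≤c fz) (sumFin-≤ n (λ i → f (fs i)) (λ i → f≤c (fs i)))

minFin-≤ : ∀ n (f : Fin n → ℕ) i → minFin n f ≤ f i
minFin-≤ (suc zero)    f fz     = ≤-refl
minFin-≤ (suc (suc n)) f fz     = m⊓n≤m _ _
minFin-≤ (suc (suc n)) f (fs i) = ≤-trans (m⊓n≤n _ _) (minFin-≤ (suc n) (λ j → f (fs j)) i)

+-double-injective : ∀ {m n} → m + m ≡ n + n → m ≡ n
+-double-injective {m} {n} eq = *-cancelˡ-≡ m n 2 (begin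
  2 * m   ≡⟨ cong (m +_) (+-identityʳ m) ⟩
  m + m   ≡⟨ eq ⟩
  n + n   ≡⟨ cong (n +_) (+-identityʳ n) ⟨
  2 * n   ∎)
  where open ≡-Reasoning

mult-sym : ∀ {k n} (G : CMG k n) u v → mult G u v ≡ mult G v u
mult-sym {k} G u v = sumFin-cong k (λ c → cong b2n (col-sym G c u v))

mult-irr : ∀ {k n} (G : CMG k n) u → mult G u u ≡ 0
mult-irr {k} G u = trans (sumFin-cong k (λ c → cong b2n (col-irr G c u))) (sumFin-zero k)

mult-≤ : ∀ {k n} (G : CMG k n) u v → mult G u v ≤ k
mult-≤ {k} G u v = subst (mult G u v ≤_) (*-identityʳ k)
  (sumFin-≤ k (λ c → b2n (col G c u v)) (λ c → b2n-≤ (col G c u v)))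
  where
  b2n-≤ : ∀ b → b2n b ≤ 1
  b2n-≤ true  = ≤-refl
  b2n-≤ false = z≤n

lowerMult : ∀ {k n} → CMG k n → Fin n → Fin n → ℕ
lowerMult G u v = if toℕ v <ᵇ toℕ u then mult G u v else 0

lowerMult-≤ : ∀ {k n} (G : CMG k n) u v → lowerMult G u v ≤ k
lowerMult-≤ G u v with toℕ v <ᵇ toℕ u
... | true  = mult-≤ G u v
... | false = z≤n

mult≡lowerMult+lowerMult : ∀ {k n} (G : CMG k n) u v →
  mult G u v ≡ lowerMult G u v + lowerMult G v u
mult≡lowerMult+lowerMult G u v
  with toℕ v <ᵇ toℕ u | <ᵇ-reflects-< (toℕ v) (toℕ u)
     | toℕ u <ᵇ toℕ v | <ᵇ-reflects-< (toℕ u) (toℕ v)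
... | true  | ofʸ v<u | true  | ofʸ u<v = ⊥-elim (<-asym v<u u<v)
... | true  | _       | false | _       = sym (+-identityʳ _)
... | false | _       | true  | _       = mult-sym G u v
... | false | ofⁿ v≮u | false | ofⁿ u≮v =
  trans (cong (mult G u) (sym (toℕ-injective (≤-antisym (≮⇒≥ v≮u) (≮⇒≥ u≮v))))) (mult-irr G u)

degreeSum : ∀ {k n} → CMG k n → ℕ
degreeSum {n = n} G = sumFin n (deg G)

handshake : ∀ {k n} (G : CMG k n) → degreeSum G ≡ eG G + eG G
handshake {n = n} G = begin
  degreeSum G
    ≡⟨ sumFin-cong n (λ u → trans (sumFin-cong n (mult≡lowerMult+lowerMult G u))
                                  (sumFin-distrib-+ n _ _)) ⟩
  sumFin n (λ u → sumFin n (lowerMult G u) + sumFin n (λ v → lowerMult G v u))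
    ≡⟨ sumFin-distrib-+ n _ _ ⟩
  eG G + sumFin n (λ u → sumFin n (λ v → lowerMult G v u))
    ≡⟨ cong (eG G +_) (sumFin-comm n n (λ u v → lowerMult G v u)) ⟩
  eG G + eG G
    ∎
  where open ≡-Reasoning

eG-≤ : ∀ {k n} (G : CMG k n) → eG G ≤ n * (n * k)
eG-≤ {n = n} G = sumFin-≤ n _ (λ u → sumFin-≤ n _ (lowerMult-≤ G u))

eG-cong : ∀ {k n} (G G′ : CMG k n) →
  (∀ c u v → col G c u v ≡ col G′ c u v) → eG G ≡ eG G′
eG-cong {k} {n} G G′ G≗G′ = sumFin-cong n λ u → sumFin-cong n λ v →
  cong (if toℕ v <ᵇ toℕ u then_else 0) (sumFin-cong k (λ c → cong b2n (G≗G′ c u v)))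

eG-≅ : ∀ {k n} (G G′ : CMG k n) → G ≅ G′ → eG G ≡ eG G′
eG-≅ {k} {n} G G′ (π , τ , G≗G′) = +-double-injective (begin
  eG G + eG G    ≡⟨ handshake G ⟨
  degreeSum G    ≡⟨ sumFin-cong n (λ u → sumFin-cong n (mult-relabel u)) ⟩
  sumFin n (λ u → sumFin n (λ v → mult G′ (Inverse.to π u) (Inverse.to π v)))
                 ≡⟨ sumFin-cong n (λ u → sumFin-permute n π (mult G′ (Inverse.to π u))) ⟩
  sumFin n (λ u → deg G′ (Inverse.to π u))
                 ≡⟨ sumFin-permute n π (deg G′) ⟩
  degreeSum G′   ≡⟨ handshake G′ ⟩
  eG G′ + eG G′  ∎)
  where
  open ≡-Reasoning
  mult-relabel : ∀ u v → mult G u v ≡ mult G′ (Inverse.to π u) (Inverse.to π v)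
  mult-relabel u v = trans (sumFin-cong k (λ c → cong b2n (G≗G′ c u v)))
    (sumFin-permute k τ (λ c → b2n (col G′ c (Inverse.to π u) (Inverse.to π v))))

removeVertex : ∀ {k n} → CMG k (suc n) → Fin (suc n) → CMG k n
removeVertex G v = record
  { col     = λ c a b → col G c (punchIn v a) (punchIn v b)
  ; col-sym = λ c a b → col-sym G c _ _
  ; col-irr = λ c a → col-irr G c _
  }

removeVertex-free : ∀ {m k n} (H : MG m) (G : CMG k (suc n)) v →
  Free H G → Free H (removeVertex G v)
removeVertex-free H G v free copy = free record
  { φ      = λ x → punchIn v (MultiCopy.φ copy x)
  ; φ-inj  = λ eq → MultiCopy.φ-inj copy (punchIn-injective v _ _ eq)
  ; S      = MultiCopy.S copy
  ; S-size = MultiCopy.S-size copy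
  ; S-edge = MultiCopy.S-edge copy
  ; S-disj = MultiCopy.S-disj copy
  }

deg-punchIn : ∀ {k n} (G : CMG k (suc n)) v →
  deg G v ≡ sumFin n (λ a → mult G (punchIn v a) v)
deg-punchIn {n = n} G v = begin
  deg G v                                  ≡⟨ sumFin-remove n v (mult G v) ⟩
  mult G v v + sumFin n (λ a → mult G v (punchIn v a))
                                           ≡⟨ cong (_+ sumFin n (λ a → mult G v (punchIn v a))) (mult-irr G v) ⟩
  sumFin n (λ a → mult G v (punchIn v a))  ≡⟨ sumFin-cong n (λ a → mult-sym G v (punchIn v a)) ⟩
  sumFin n (λ a → mult G (punchIn v a) v)  ∎
  where open ≡-Reasoning

degreeSum-removeVertex : ∀ {k n} (G : CMG k (suc n)) v →
  degreeSum G ≡ degreeSum (removeVertex G v) + (deg G v + deg G v)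
degreeSum-removeVertex {n = n} G v = begin
  degreeSum G
    ≡⟨ sumFin-remove n v (deg G) ⟩
  d + sumFin n (λ a → deg G (punchIn v a))
    ≡⟨ cong (d +_) (sumFin-cong n (λ a → sumFin-remove n v (mult G (punchIn v a)))) ⟩
  d + sumFin n (λ a → mult G (punchIn v a) v + deg G-v a)
    ≡⟨ cong (d +_) (sumFin-distrib-+ n _ _) ⟩
  d + (sumFin n (λ a → mult G (punchIn v a) v) + degreeSum G-v)
    ≡⟨ cong (λ d′ → d + (d′ + degreeSum G-v)) (deg-punchIn G v) ⟨
  d + (d + degreeSum G-v)
    ≡⟨ +-assoc d d (degreeSum G-v) ⟨
  d + d + degreeSum G-v
    ≡⟨ +-comm (d + d) (degreeSum G-v) ⟩
  degreeSum G-v + (d + d)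
    ∎
  where
  open ≡-Reasoning
  d   = deg G v
  G-v = removeVertex G v

eG-removeVertex : ∀ {k n} (G : CMG k (suc n)) v → eG G ≡ eG (removeVertex G v) + deg G v
eG-removeVertex G v = +-double-injective (begin
  eG G + eG G                  ≡⟨ handshake G ⟨
  degreeSum G                  ≡⟨ degreeSum-removeVertex G v ⟩
  degreeSum G-v + (d + d)      ≡⟨ cong (_+ (d + d)) (handshake G-v) ⟩
  (eG G-v + eG G-v) + (d + d)  ≡⟨ interchange (eG G-v) (eG G-v) d d ⟩
  (eG G-v + d) + (eG G-v + d)  ∎)
  where
  open ≡-Reasoning
  d   = deg G v
  G-v = removeVertex G v

eG-removeVertex-minDeg : ∀ {k n} (G : CMG k (suc n)) v →
  eG (removeVertex G v) + minDeg G ≤ eG G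
eG-removeVertex-minDeg {n = n} G v =
  subst (eG (removeVertex G v) + minDeg G ≤_) (sym (eG-removeVertex G v))
        (+-monoʳ-≤ (eG (removeVertex G v)) (minFin-≤ (suc n) (deg G) v))

toℕ-punchIn-fromℕ : ∀ n (a : Fin n) → toℕ (punchIn (fromℕ n) a) ≡ toℕ a
toℕ-punchIn-fromℕ (suc n) fz     = refl
toℕ-punchIn-fromℕ (suc n) (fs a) = cong suc (toℕ-punchIn-fromℕ n a)

A-removeLast : ∀ r h k n c a b →
  col (removeVertex (A r h k (suc n)) (fromℕ n)) c a b ≡ col (A r h k n) c a b
A-removeLast r h k n = by-case ((k * (r ∸ 2)) <ᵇ ((r ∸ 1) * (h ∸ 1)))
  where
  by-case : ∀ β c a b →
    col (if β then hKn h k (suc n) else kT r k (suc n)) c (punchIn (fromℕ n) a) (punchIn (fromℕ n) b)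
    ≡ col (if β then hKn h k n else kT r k n) c a b
  by-case true  c a b rewrite toℕ-punchIn-fromℕ n a | toℕ-punchIn-fromℕ n b = refl
  by-case false c a b rewrite toℕ-punchIn-fromℕ n a | toℕ-punchIn-fromℕ n b = refl

A-growth : ∀ r h k n → eG (A r h k n) + minDeg (A r h k (suc n)) ≤ eG (A r h k (suc n))
A-growth r h k n =
  subst (λ e → e + minDeg (A r h k (suc n)) ≤ eG (A r h k (suc n)))
        (eG-cong (removeVertex (A r h k (suc n)) (fromℕ n)) (A r h k n) (A-removeLast r h k n))
        (eG-removeVertex-minDeg (A r h k (suc n)) (fromℕ n))

DegreeStable : ∀ {m k} → MG m → (∀ n → CMG k n) → ℕ → Set
DegreeStable {k = k} H A M₀ = ∀ n → M₀ < n →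
  Free H (A n) ×
  (∀ (G : CMG k n) → Free H G → eG (A n) ≤ eG G → (∀ u → minDeg (A n) ≤ deg G u) → G ≅ A n)

surplus-step : ∀ {a b c d e t} → a + c ≤ b → b + t ≤ e + d → d < c → a + suc t ≤ e
surplus-step {a} {b} {c} {d} {e} {t} a+c≤b b+t≤e+d d<c = +-cancelʳ-≤ d (a + suc t) e (begin
  a + suc t + d  ≡⟨ +-assoc a (suc t) d ⟩
  a + (suc t + d) ≡⟨ cong (a +_) (+-suc t d) ⟨
  a + (t + suc d) ≤⟨ +-monoʳ-≤ a (+-monoʳ-≤ t d<c) ⟩
  a + (t + c)    ≡⟨ cong (a +_) (+-comm t c) ⟩
  a + (c + t)    ≡⟨ +-assoc a c t ⟨
  a + c + t      ≤⟨ +-monoˡ-≤ t a+c≤b ⟩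
  b + t          ≤⟨ b+t≤e+d ⟩
  e + d          ∎)
  where open ≤-Reasoning

module DeletionArgument {m k} (H : MG m) (A : ∀ n → CMG k n) (M₀ : ℕ)
  (growth : ∀ n → eG (A n) + minDeg (A (suc n)) ≤ eG (A (suc n)))
  (stable : DegreeStable H A M₀) where

  threshold : ℕ
  threshold = M₀ * (M₀ * k) + M₀

  M₀<n : ∀ {n} → threshold < n → M₀ < n
  M₀<n = ≤-<-trans (m≤n+m M₀ _)

  low-degree-or-≅ : ∀ {n t} → M₀ < suc n → (G : CMG k (suc n)) → Free H G →
    eG (A (suc n)) + t ≤ eG G →
    G ≅ A (suc n) ⊎ Σ (Fin (suc n)) λ u → eG (A n) + suc t ≤ eG (removeVertex G u)
  low-degree-or-≅ {n} {t} M₀<n G free dense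
    with all? (λ u → minDeg (A (suc n)) ≤? deg G u)
  ... | yes high = inj₁ (proj₂ (stable (suc n) M₀<n) G free (m+n≤o⇒m≤o _ dense) high)
  ... | no ¬high with ¬∀⟶∃¬ _ _ (λ u → minDeg (A (suc n)) ≤? deg G u) ¬high
  ... | u , low = inj₂ (u , surplus-step (growth n) dense-after-removal (≰⇒> low))
    where
    dense-after-removal : eG (A (suc n)) + t ≤ eG (removeVertex G u) + deg G u
    dense-after-removal = subst (eG (A (suc n)) + t ≤_) (eG-removeVertex G u) dense

  few-vertices-surplus-bounded : ∀ {n t} → n ≤ M₀ → (G : CMG k n) →
    eG (A n) + suc t ≤ eG G → suc t + n ≤ threshold
  few-vertices-surplus-bounded {n} n≤M₀ G dense = +-mono-≤ (begin
    suc _         ≤⟨ m+n≤o⇒n≤o _ dense ⟩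
    eG G          ≤⟨ eG-≤ G ⟩
    n * (n * k)   ≤⟨ *-mono-≤ n≤M₀ (*-monoˡ-≤ k n≤M₀) ⟩
    M₀ * (M₀ * k) ∎) n≤M₀
    where open ≤-Reasoning

  surplus-bounded : ∀ n (G : CMG k n) → Free H G → ∀ t → eG (A n) + suc t ≤ eG G →
    suc t + n ≤ threshold
  surplus-bounded zero G free t dense = few-vertices-surplus-bounded z≤n G dense
  surplus-bounded (suc n) G free t dense with M₀ ≤? n
  ... | no M₀≰n = few-vertices-surplus-bounded (≰⇒> M₀≰n) G dense
  ... | yes M₀≤n with low-degree-or-≅ (s≤s M₀≤n) G free dense
  ...   | inj₁ G≅A = ⊥-elim (m+1+n≰m (eG (A (suc n)))
                       (subst (eG (A (suc n)) + suc t ≤_) (eG-≅ G (A (suc n)) G≅A) dense))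
  ...   | inj₂ (u , dense′) =
    subst (_≤ threshold) (sym (+-suc (suc t) n))
          (surplus-bounded n (removeVertex G u) (removeVertex-free H G u free) (suc t) dense′)

  dense-free-≅ : ∀ {n} → threshold < n → (G : CMG k n) → Free H G →
    eG (A n) ≤ eG G → G ≅ A n
  dense-free-≅ {suc n} threshold<n G free dense
    with low-degree-or-≅ (M₀<n threshold<n) G free (subst (_≤ eG G) (sym (+-identityʳ _)) dense)
  ... | inj₁ G≅A = G≅A
  ... | inj₂ (u , dense′) = ⊥-elim (<⇒≱ threshold<n
        (surplus-bounded n (removeVertex G u) (removeVertex-free H G u free) 0 dense′))

  uniquely-extremal : ∀ {n} → threshold < n →
    Extremal H (A n) × (∀ (G : CMG k n) → Extremal H G → G ≅ A n)
  uniquely-extremal {n} threshold<n = (A-free , maximal) , unique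
    where
    A-free : Free H (A n)
    A-free = proj₁ (stable n (M₀<n threshold<n))
    maximal : ∀ (G : CMG k n) → Free H G → eG G ≤ eG (A n)
    maximal G free = ≮⇒≥ λ A<G →
      <-irrefl (sym (eG-≅ G (A n) (dense-free-≅ threshold<n G free (<⇒≤ A<G)))) A<G
    unique : ∀ (G : CMG k n) → Extremal H G → G ≅ A n
    unique G (free , max) = dense-free-≅ threshold<n G free (max (A n) A-free)

proposition3p3 : (k M₀ : ℕ) → Σ ℕ λ n₀ →
    (r m : ℕ) (H : MG m) → 3 ≤ r → ColorCritical r H → eMG H ≤ k →
    (∀ n → M₀ < n →
      Free H (A r (eMG H) k n) ×
      (∀ (G : CMG k n) → Free H G → eG (A r (eMG H) k n) ≤ eG G →
        (∀ u → minDeg (A r (eMG H) k n) ≤ deg G u) → G ≅ A r (eMG H) k n)) →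
    ∀ n → n₀ < n →
      Extremal H (A r (eMG H) k n) × (∀ (G : CMG k n) → Extremal H G → G ≅ A r (eMG H) k n)
proposition3p3 k M₀ = M₀ * (M₀ * k) + M₀ , λ r m H _ _ _ stable n n₀<n →
  DeletionArgument.uniquely-extremal H (A r (eMG H) k) M₀ (A-growth r (eMG H) k) stable n₀<n
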